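{- Let $((A,\to),\mathrm{obs})$ be a QARS which is skew-confluent, i.e. for all $t,s,r\in A$ with $t\to^*s$ and $t\to^*r$ there is $s'$ with $s\to^*s'$ and $\mathrm{obs}(r)\le\mathrm{obs}(s')$. Then it satisfies the Limit Property: for all $t,s\in A$, if $\mathbf p\in\mathrm{Lim}_{\mathrm{obs}}(t)$ and $t\to^*s$, then there exists $\mathbf q\in\mathrm{Lim}_{\mathrm{obs}}(t)$ such that some maximal $\to$-sequence $\langle s_n\rangle$ from $s$ satisfies $\sup_n\mathrm{obs}(s_n)=\mathbf q$, and $\mathbf p\le\mathbf q$.
   Context: A QARS is an abstract rewrite system $(A,\to)$ (a set with a binary relation; $\to^*$ its reflexive–transitive closure) together with a map $\mathrm{obs}:A\to S$, where $(S,\le)$ is an $\omega$-complete partial order (every ascending chain has a supremum) with a least element, such that $t\to s$ implies $\mathrm{obs}(t)\le\mathrm{obs}(s)$. An element is a normal form if it has no $\to$-successor. A maximal $\to$-sequence from $t$ is an infinite sequence $t=t_0,t_1,t_2,\dots$ such that for each $i$ either $t_i\to t_{i+1}$, or $t_i=t_{i+1}$ is a normal form. $\mathrm{Lim}_{\mathrm{obs}}(t)$ is the set of all $\sup_n\mathrm{obs}(t_n)$ for $\langle t_n\rangle$ a maximal $\to$-sequence from $t$. -}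

module Defs where

open import Level using (Level; _⊔_; suc)
open import Data.Nat using (ℕ; zero) renaming (suc to sucℕ)
open import Data.Product using (Σ; _×_; ∃)
open import Data.Sum using (_⊎_)
open import Relation.Nullary using (¬_)
open import Relation.Binary.Core using (Rel)
open import Relation.Binary.Bundles using (Poset)
open import Relation.Binary.PropositionalEquality using (_≡_)
open import Relation.Binary.Construct.Closure.ReflexiveTransitive using (Star)

record ωCPO (c ℓ₁ ℓ₂ : Level) : Set (suc (c ⊔ ℓ₁ ⊔ ℓ₂)) where
  field
    poset : Poset c ℓ₁ ℓ₂
  open Poset poset public
  Ascending : (ℕ → Carrier) → Set ℓ₂
  Ascending f = ∀ n → f n ≤ f (sucℕ n)
  IsSup : (ℕ → Carrier) → Carrier → Set (c ⊔ ℓ₂)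
  IsSup f x = (∀ n → f n ≤ x) × (∀ y → (∀ n → f n ≤ y) → x ≤ y)
  field
    ⊥ₛ      : Carrier
    ⊥-least : ∀ x → ⊥ₛ ≤ x
    sup-exists : ∀ f → Ascending f → Σ Carrier (IsSup f)

record QARS {c ℓ₁ ℓ₂ : Level} (S : ωCPO c ℓ₁ ℓ₂) (a r : Level)
       : Set (c ⊔ ℓ₁ ⊔ ℓ₂ ⊔ suc (a ⊔ r)) where
  open ωCPO S
  field
    A    : Set a
    _⟶_  : Rel A r
    obs  : A → Carrier
    obs-mono : ∀ {t s} → t ⟶ s → obs t ≤ obs s

  _⟶*_ : Rel A (a ⊔ r)
  _⟶*_ = Star _⟶_

  NormalForm : A → Set (a ⊔ r)
  NormalForm t = ∀ s → ¬ (t ⟶ s)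

  IsMaximalSeq : A → (ℕ → A) → Set (a ⊔ r)
  IsMaximalSeq t u =
    (u zero ≡ t) ×
    (∀ i → (u i ⟶ u (sucℕ i)) ⊎ ((u i ≡ u (sucℕ i)) × NormalForm (u i)))

  _∈Lim_ : Carrier → A → Set (c ⊔ ℓ₂ ⊔ a ⊔ r)
  p ∈Lim t = Σ (ℕ → A) λ u → IsMaximalSeq t u × IsSup (λ n → obs (u n)) p

  SkewConfluent : Set (a ⊔ r ⊔ ℓ₂)
  SkewConfluent = ∀ {t s r′} → t ⟶* s → t ⟶* r′ →
                  Σ A λ s′ → (s ⟶* s′) × (obs r′ ≤ obs s′)

  LimitProperty : Set (c ⊔ ℓ₂ ⊔ a ⊔ r)
  LimitProperty = ∀ {t s} p → p ∈Lim t → t ⟶* s →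
    Σ Carrier λ q → (q ∈Lim t) ×
      ((Σ (ℕ → A) λ v → IsMaximalSeq s v × IsSup (λ n → obs (v n)) q)
       × (p ≤ q))

module Submission where

open import Defs
open import Level using (Level; _⊔_)
open import Axiom.ExcludedMiddle using (ExcludedMiddle)
open import Data.Nat using (ℕ; zero; suc)
open import Data.Product using (Σ; ∃; _×_; _,_; proj₁; proj₂)
open import Data.Sum using (_⊎_; inj₁; inj₂)
open import Function using (_∘_)
open import Relation.Nullary using (yes; no)
open import Relation.Binary.Core using (Rel)
open import Relation.Binary.PropositionalEquality using (_≡_; refl; sym; cong)
open import Relation.Binary.Construct.Closure.ReflexiveTransitive using (ε; _◅_; _◅◅_)

-- Chase the given maximal sequence u from s: by skew-confluence every obs (u n) is dominated
-- by some element reachable from the previous one, and excluded middle lets each link make a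
-- genuine step unless it is stuck at a normal form.  Stitching the links gives a maximal
-- sequence whose supremum is that of the chosen elements X n; the same stitching starting from
-- t (through t ⟶* s = X 0) has the same supremum, so this q lies in Lim t and dominates p.

module _ {c ℓ₁ ℓ₂ : Level} (S : ωCPO c ℓ₁ ℓ₂) where
  open ωCPO S renaming (trans to ≤-trans)

  IsSup-cofinal : ∀ {f g q} → IsSup f q →
                  (∀ n → ∃ λ m → f n ≤ g m) → (∀ m → ∃ λ n → g m ≤ f n) → IsSup g q
  IsSup-cofinal (f≤q , q-least) f≤g g≤f =
    (λ m → ≤-trans (proj₂ (g≤f m)) (f≤q (proj₁ (g≤f m))))
    , λ y g≤y → q-least y (λ n → ≤-trans (proj₂ (f≤g n)) (g≤y (proj₁ (f≤g n))))

module _ {c ℓ₁ ℓ₂ a r : Level} {S : ωCPO c ℓ₁ ℓ₂} (Q : QARS S a r) where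
  open ωCPO S renaming (refl to ≤-refl; trans to ≤-trans; reflexive to ≤-reflexive)
  open QARS Q

  _⇝_ : Rel A (a ⊔ r)
  x ⇝ y = (x ⟶ y) ⊎ ((x ≡ y) × NormalForm x)

  Advance : Rel A (a ⊔ r)
  Advance x y = Σ A λ z → (x ⇝ z) × (z ⟶* y)

  obs-mono* : ∀ {x y} → x ⟶* y → obs x ≤ obs y
  obs-mono* ε = ≤-refl
  obs-mono* (st ◅ p) = ≤-trans (obs-mono st) (obs-mono* p)

  ⇝⇒⟶* : ∀ {x y} → x ⇝ y → x ⟶* y
  ⇝⇒⟶* (inj₁ st) = st ◅ ε
  ⇝⇒⟶* (inj₂ (refl , _)) = ε

  Advance⇒⟶* : ∀ {x y} → Advance x y → x ⟶* y
  Advance⇒⟶* (_ , x⇝z , z⟶*y) = ⇝⇒⟶* x⇝z ◅◅ z⟶*y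

  maximalSeq-reachable : ∀ {t u} → IsMaximalSeq t u → ∀ n → t ⟶* u n
  maximalSeq-reachable (refl , _) zero = ε
  maximalSeq-reachable mu@(_ , steps) (suc n) =
    maximalSeq-reachable mu n ◅◅ ⇝⇒⟶* (steps n)

  advance : ExcludedMiddle (a ⊔ r) → ∀ {x y} → x ⟶* y → Σ A λ z → Advance x z × (y ⟶* z)
  advance em (st ◅ p) = _ , (_ , inj₁ st , p) , ε
  advance em {x} ε with em {Σ A (x ⟶_)}
  ... | yes (z , st) = z , (z , inj₁ st , ε) , st ◅ ε
  ... | no stuck = x , (x , inj₂ (refl , λ z st → stuck (z , st)) , ε) , ε

  module Stitch (X : ℕ → A) (adv : ∀ n → Advance (X n) (X (suc n))) where

    -- (n , y , path) : the stitched sequence is at y, on the remaining path to X n.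
    State : Set (a ⊔ r)
    State = Σ ℕ λ n → Σ A λ x → x ⟶* X n

    step : State → State
    step (n , _ , st ◅ rest) = n , _ , rest
    step (n , _ , ε) = suc n , proj₁ (adv n) , proj₂ (proj₂ (adv n))

    step-⇝ : ∀ σ → proj₁ (proj₂ σ) ⇝ proj₁ (proj₂ (step σ))
    step-⇝ (n , _ , st ◅ rest) = inj₁ st
    step-⇝ (n , _ , ε) = proj₁ (proj₂ (adv n))

    module _ {x : A} (x⟶*X₀ : x ⟶* X 0) where

      run : ℕ → State
      run zero = 0 , x , x⟶*X₀
      run (suc m) = step (run m)

      w : ℕ → A
      w = proj₁ ∘ proj₂ ∘ run

      drain : ∀ m {n y} (rest : y ⟶* X n) → run m ≡ (n , y , rest) →
              ∃ λ m′ → run m′ ≡ (n , X n , ε)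
      drain m ε eq = m , eq
      drain m (_ ◅ rest) eq = drain (suc m) rest (cong step eq)

      visits : ∀ n → ∃ λ m → w m ≡ X n
      visits n = proj₁ (arrive n) , cong (proj₁ ∘ proj₂) (proj₂ (arrive n))
        where
        arrive : ∀ n → ∃ λ m → run m ≡ (n , X n , ε)
        arrive zero = drain 0 x⟶*X₀ refl
        arrive (suc n) with arrive n
        ... | m , eq = drain (suc m) (proj₂ (proj₂ (adv n))) (cong step eq)

      stitch-∈Lim : ∀ {q} → IsSup (obs ∘ X) q → q ∈Lim x
      stitch-∈Lim supX =
        w , (refl , step-⇝ ∘ run) ,
        IsSup-cofinal S supX
          (λ n → proj₁ (visits n) , ≤-reflexive (Eq.reflexive (cong obs (sym (proj₂ (visits n))))))
          (λ m → proj₁ (run m) , obs-mono* (proj₂ (proj₂ (run m))))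

  module Chase (em : ExcludedMiddle (a ⊔ r)) (skew : SkewConfluent)
               {t s : A} (t⟶*s : t ⟶* s) (u : ℕ → A) (t⟶*u : ∀ n → t ⟶* u n) where

    next : ∀ {x} → t ⟶* x → ∀ n → Σ A λ z → Advance x z × (obs (u n) ≤ obs z)
    next t⟶*x n with skew t⟶*x (t⟶*u n)
    ... | y , x⟶*y , u≤y with advance em x⟶*y
    ...   | z , x↠z , y⟶*z = z , x↠z , ≤-trans u≤y (obs-mono* y⟶*z)

    X : ℕ → A
    t⟶*X : ∀ n → t ⟶* X n
    X-advance : ∀ n → Advance (X n) (X (suc n))

    X zero = s
    X (suc n) = proj₁ (next (t⟶*X n) n)

    t⟶*X zero = t⟶*s
    t⟶*X (suc n) = t⟶*X n ◅◅ Advance⇒⟶* (X-advance n)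

    X-advance n = proj₁ (proj₂ (next (t⟶*X n) n))

    u≤X : ∀ n → obs (u n) ≤ obs (X (suc n))
    u≤X n = proj₂ (proj₂ (next (t⟶*X n) n))

    X-ascending : Ascending (obs ∘ X)
    X-ascending n = obs-mono* (Advance⇒⟶* (X-advance n))

    dominating-limit : ∀ {p} → IsSup (obs ∘ u) p →
                       Σ Carrier λ q → q ∈Lim t × q ∈Lim s × p ≤ q
    dominating-limit u-sup with sup-exists (obs ∘ X) X-ascending
    ... | q , q-sup =
      q , stitch-∈Lim t⟶*s q-sup , stitch-∈Lim ε q-sup ,
      proj₂ u-sup q (λ n → ≤-trans (u≤X n) (proj₁ q-sup (suc n)))
      where open Stitch X X-advance

  limitProperty : ExcludedMiddle (a ⊔ r) → SkewConfluent → LimitProperty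
  limitProperty em skew p (u , u-max , u-sup) t⟶*s =
    Chase.dominating-limit em skew t⟶*s u (maximalSeq-reachable u-max) u-sup

mainTheorem2 : {c ℓ₁ ℓ₂ a r : Level} (S : ωCPO c ℓ₁ ℓ₂) (Q : QARS S a r) →
    ExcludedMiddle (a ⊔ r) →
    QARS.SkewConfluent Q → QARS.LimitProperty Q
mainTheorem2 S Q = limitProperty Q
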